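{- Let $\Sigma$ be a signature and $T$ the effect-tree monad over $\Sigma$. Let $(A,\sqsubseteq)$ be a preorder and let $\alpha: TA \to A$ be an Eilenberg–Moore algebra for $T$. Then the relation $\sqsubseteq_\alpha$ on $T\mathbb{N}$ is substitutional: for all $a,b \in T\mathbb{N}$ with $a \sqsubseteq_\alpha b$ and every function $f:\mathbb{N}\to T\mathbb{N}$, we have $f^*(a) \sqsubseteq_\alpha f^*(b)$.
   Context: A signature $\Sigma$ is a set of operators $\sigma$, each with an arity $|\sigma| \in \mathbb{N}\cup\{\mathbb{N}\}$. For a set $X$, $TX$ is the set of labelled trees of possibly infinite depth whose nodes are: a leaf labelled $\bot$; a leaf labelled $\top$; a leaf $\langle x\rangle$ with $x\in X$; a node labelled $\sigma$ with children $t_1,\dots,t_m$ if $|\sigma|=m$; or a node labelled $\sigma$ with an infinite sequence of children $t_0,t_1,\dots$ if $|\sigma|=\mathbb{N}$ (written $\sigma\langle m\mapsto t_m\rangle$). $T$ is a functor on sets: for $f:X\to Y$, $Tf$ replaces each leaf $\langle x\rangle$ by $\langle f(x)\rangle$. It is a monad with unit $\eta(x)=\langle x\rangle$ and multiplication $\mu: TTX\to TX$ replacing each leaf $\langle t\rangle$ by the subtree $t$. For $f:X\to TY$, $f^* := \mu\circ Tf : TX\to TY$. An Eilenberg–Moore algebra is a map $\alpha:TA\to A$ with $\alpha\circ\eta_A=\mathrm{id}_A$ and $\alpha\circ T\alpha = \alpha\circ\mu_A$. For a preorder $(A,\sqsubseteq)$ and such $\alpha$, define for $a,b\in T\mathbb{N}$: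 $a\sqsubseteq_\alpha b$ iff for every $h:\mathbb{N}\to A$, $\alpha(Th(a))\sqsubseteq \alpha(Th(b))$. -}

module Defs where

open import Data.Nat using (ℕ; _<_)
open import Data.Unit using (⊤; tt)
open import Data.Empty using (⊥)
open import Data.Product using (_×_; _,_; proj₁; proj₂)
open import Data.Maybe using (Maybe; just; nothing)
open import Data.List using (List; []; _∷_; _++_; [_])
open import Relation.Binary.PropositionalEquality using (_≡_)

data Arity : Set where
  fin   : ℕ → Arity
  omega : Arity

ValidPos : Arity → ℕ → Set
ValidPos (fin m) i = i < m
ValidPos omega   i = ⊤

record Signature : Set₁ where
  field
    Op    : Set
    arity : Op → Arity

-- A (possibly infinite) labelled tree is represented by its labelling of
-- paths: a path is a list of child indices read from the root, and
-- 'at p' is the label of the node reached by p ('nothing' if there is no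
-- such node).  Well-formedness says the root exists and the children of
-- the node at p are exactly those allowed by its label (leaves ⊥, ⊤, ⟨x⟩
-- have none; σ has exactly its |σ| children).  Two trees are the same
-- tree iff they have the same labelling.

Defined : {B : Set} → Maybe B → Set
Defined (just _) = ⊤
Defined nothing  = ⊥

module _ (S : Signature) where
  open Signature S

  data Label (X : Set) : Set where
    bot  : Label X
    top  : Label X
    leaf : X → Label X
    node : Op → Label X

  ChildOK : {X : Set} → Maybe (Label X) → ℕ → Set
  ChildOK (just (node σ)) i = ValidPos (arity σ) i
  ChildOK _               i = ⊥

  ChildCond : {X : Set} → (List ℕ → Maybe (Label X)) → Set
  ChildCond g = ∀ (p : List ℕ) (i : ℕ) →
                  (Defined (g (p ++ [ i ])) → ChildOK (g p) i) ×
                  (ChildOK (g p) i → Defined (g (p ++ [ i ])))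

  record T (X : Set) : Set where
    field
      at    : List ℕ → Maybe (Label X)
      root  : Defined (at [])
      child : ChildCond at
  open T public

  _≈T_ : {X : Set} → T X → T X → Set
  s ≈T t = ∀ p → at s p ≡ at t p

  mapLabel : {X Y : Set} → (X → Y) → Label X → Label Y
  mapLabel f bot      = bot
  mapLabel f top      = top
  mapLabel f (leaf x) = leaf (f x)
  mapLabel f (node σ) = node σ

  mapML : {X Y : Set} → (X → Y) → Maybe (Label X) → Maybe (Label Y)
  mapML f (just l) = just (mapLabel f l)
  mapML f nothing  = nothing

  private
    defMap : {X Y : Set} (f : X → Y) (m : Maybe (Label X)) →
             (Defined (mapML f m) → Defined m) × (Defined m → Defined (mapML f m))
    defMap f (just _) = (λ _ → tt) , (λ _ → tt)
    defMap f nothing  = (λ ()) , (λ ())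

    okMap : {X Y : Set} (f : X → Y) (m : Maybe (Label X)) (i : ℕ) →
            (ChildOK (mapML f m) i → ChildOK m i) × (ChildOK m i → ChildOK (mapML f m) i)
    okMap f (just bot)      i = (λ ()) , (λ ())
    okMap f (just top)      i = (λ ()) , (λ ())
    okMap f (just (leaf x)) i = (λ ()) , (λ ())
    okMap f (just (node σ)) i = (λ v → v) , (λ v → v)
    okMap f nothing         i = (λ ()) , (λ ())

  Tmap : {X Y : Set} → (X → Y) → T X → T Y
  at    (Tmap f t) p = mapML f (at t p)
  root  (Tmap f t)   = proj₂ (defMap f (at t [])) (root t)
  child (Tmap f t) p i =
    (λ d → proj₂ (okMap f (at t p) i)
             (proj₁ (child t p i) (proj₁ (defMap f (at t (p ++ [ i ]))) d))) ,
    (λ o → proj₂ (defMap f (at t (p ++ [ i ])))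
             (proj₂ (child t p i) (proj₁ (okMap f (at t p) i) o)))

  ηat : {X : Set} → X → List ℕ → Maybe (Label X)
  ηat x []      = just (leaf x)
  ηat x (_ ∷ _) = nothing

  η : {X : Set} → X → T X
  at    (η x) = ηat x
  root  (η x) = tt
  child (η x) []      i = (λ ()) , (λ ())
  child (η x) (_ ∷ _) i = (λ ()) , (λ ())

  -- Multiplication: μ replaces each leaf ⟨t⟩ by the subtree t.

  μat : {X : Set} → (List ℕ → Maybe (Label (T X))) → List ℕ → Maybe (Label X)
  μat g p with g []
  μat g p       | just (leaf t) = at t p
  μat g []      | just bot      = just bot
  μat g []      | just top      = just top
  μat g []      | just (node σ) = just (node σ)
  μat g (i ∷ p) | just (node σ) = μat (λ q → g (i ∷ q)) p
  μat g (i ∷ p) | just bot      = nothing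
  μat g (i ∷ p) | just top      = nothing
  μat g []      | nothing       = nothing
  μat g (i ∷ p) | nothing       = nothing

  private
    μroot : {X : Set} (g : List ℕ → Maybe (Label (T X))) →
            (Defined (μat g []) → Defined (g [])) × (Defined (g []) → Defined (μat g []))
    μroot g with g []
    ... | just (leaf t) = (λ _ → tt) , (λ _ → root t)
    ... | just bot      = (λ _ → tt) , (λ _ → tt)
    ... | just top      = (λ _ → tt) , (λ _ → tt)
    ... | just (node σ) = (λ _ → tt) , (λ _ → tt)
    ... | nothing       = (λ ()) , (λ ())

    μchild : {X : Set} (g : List ℕ → Maybe (Label (T X))) → ChildCond g →
             ChildCond (μat g)
    μchild g cg [] i with g [] | cg [] i
    ... | just (leaf t) | _ = child t [] i
    ... | just bot      | c = (λ ()) , (λ ())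
    ... | just top      | c = (λ ()) , (λ ())
    ... | just (node σ) | c = (λ d → proj₁ c (proj₁ (μroot (λ q → g (i ∷ q))) d))
                            , (λ o → proj₂ (μroot (λ q → g (i ∷ q))) (proj₂ c o))
    ... | nothing       | c = (λ ()) , (λ ())
    μchild g cg (j ∷ p) i with g []
    ... | just (leaf t) = child t (j ∷ p) i
    ... | just bot      = (λ ()) , (λ ())
    ... | just top      = (λ ()) , (λ ())
    ... | just (node σ) = μchild (λ q → g (j ∷ q)) (λ q k → cg (j ∷ q) k) p i
    ... | nothing       = (λ ()) , (λ ())

  μ : {X : Set} → T (T X) → T X
  at    (μ t) = μat (at t)
  root  (μ t) = proj₂ (μroot (at t)) (root t)
  child (μ t) = μchild (at t) (child t)

  _* : {X Y : Set} → (X → T Y) → T X → T Y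
  (f *) t = μ (Tmap f t)

  -- Eilenberg–Moore algebras.  α must be a function on trees, i.e. it
  -- cannot distinguish two representations of the same tree.

  record IsEMAlgebra {A : Set} (α : T A → A) : Set where
    field
      respects-≈ : ∀ {s t : T A} → s ≈T t → α s ≡ α t
      unit       : ∀ (a : A) → α (η a) ≡ a
      mult       : ∀ (t : T (T A)) → α (Tmap α t) ≡ α (μ t)

  Below : {A : Set} → (A → A → Set) → (T A → A) → T ℕ → T ℕ → Set
  Below {A} _⊑_ α a b = ∀ (h : ℕ → A) → α (Tmap h a) ⊑ α (Tmap h b)

-- The idea: for h : ℕ → A and f : ℕ → T ℕ, evaluating the substituted tree
-- f*(a) under h is the same as evaluating a itself under the composite
-- valuation  h' n := α (Th (f n)):
--
--     α (Th (f* a)) = α (T(α ∘ Th ∘ f) a).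
--
-- Hence  α (Th (f* a)) ⊑ α (Th (f* b))  is the instance h' of the hypothesis
-- a ⊑_α b.  The identity above follows from the algebra law
-- α ∘ Tα = α ∘ μ together with two facts about trees, proved first on the
-- path-labelling representation: T preserves composition, and μ is natural
-- (Th ∘ μ = μ ∘ TTh) and respects labelling-equality.
module Submission where

open import Defs
open import Data.Nat using (ℕ)
open import Data.List using (List; []; _∷_)
open import Data.Maybe using (Maybe; just; nothing)
open import Relation.Binary.PropositionalEquality
  using (_≡_; refl; sym; trans; subst₂; module ≡-Reasoning)
open import Relation.Binary.Structures using (IsPreorder)

module _ (S : Signature) where

  mapML-∘ : {X Y Z : Set} (f : X → Y) (g : Y → Z) (m : Maybe (Label S X)) →
            mapML S g (mapML S f m) ≡ mapML S (λ x → g (f x)) m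
  mapML-∘ f g (just bot)      = refl
  mapML-∘ f g (just top)      = refl
  mapML-∘ f g (just (leaf x)) = refl
  mapML-∘ f g (just (node σ)) = refl
  mapML-∘ f g nothing         = refl

  Tmap-∘ : {X Y Z : Set} (f : X → Y) (g : Y → Z) (t : T S X) →
           _≈T_ S (Tmap S g (Tmap S f t)) (Tmap S (λ x → g (f x)) t)
  Tmap-∘ f g t p = mapML-∘ f g (at t p)

  μat-cong : {X : Set} (g g′ : List ℕ → Maybe (Label S (T S X))) →
             (∀ q → g q ≡ g′ q) → ∀ p → μat S g p ≡ μat S g′ p
  μat-cong g g′ e p with g [] | g′ [] | e []
  μat-cong g g′ e p       | just (leaf t) | _ | refl = refl
  μat-cong g g′ e []      | just bot      | _ | refl = refl
  μat-cong g g′ e []      | just top      | _ | refl = refl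
  μat-cong g g′ e []      | just (node σ) | _ | refl = refl
  μat-cong g g′ e (i ∷ p) | just (node σ) | _ | refl =
    μat-cong (λ q → g (i ∷ q)) (λ q → g′ (i ∷ q)) (λ q → e (i ∷ q)) p
  μat-cong g g′ e (i ∷ p) | just bot      | _ | refl = refl
  μat-cong g g′ e (i ∷ p) | just top      | _ | refl = refl
  μat-cong g g′ e []      | nothing       | _ | refl = refl
  μat-cong g g′ e (i ∷ p) | nothing       | _ | refl = refl

  μat-natural : {X Y : Set} (h : X → Y) (g : List ℕ → Maybe (Label S (T S X))) →
                ∀ p → mapML S h (μat S g p) ≡ μat S (λ q → mapML S (Tmap S h) (g q)) p
  μat-natural h g p with g []
  μat-natural h g p       | just (leaf t) = refl
  μat-natural h g []      | just bot      = refl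
  μat-natural h g []      | just top      = refl
  μat-natural h g []      | just (node σ) = refl
  μat-natural h g (i ∷ p) | just (node σ) = μat-natural h (λ q → g (i ∷ q)) p
  μat-natural h g (i ∷ p) | just bot      = refl
  μat-natural h g (i ∷ p) | just top      = refl
  μat-natural h g []      | nothing       = refl
  μat-natural h g (i ∷ p) | nothing       = refl

  Tmap-* : {X Y Z : Set} (h : Y → Z) (f : X → T S Y) (t : T S X) →
           _≈T_ S (Tmap S h (_* S f t)) (_* S (λ x → Tmap S h (f x)) t)
  Tmap-* h f t p = trans (μat-natural h (at (Tmap S f t)) p)
                         (μat-cong _ _ (λ q → mapML-∘ f (Tmap S h) (at t q)) p)

  evaluate-* : {A : Set} (α : T S A → A) → IsEMAlgebra S α →
               (f : ℕ → T S ℕ) (h : ℕ → A) (t : T S ℕ) →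
               α (Tmap S h (_* S f t)) ≡ α (Tmap S (λ n → α (Tmap S h (f n))) t)
  evaluate-* α em f h t = begin
      α (Tmap S h (_* S f t))
    ≡⟨ respects-≈ (Tmap-* h f t) ⟩
      α (μ S (Tmap S hf t))
    ≡⟨ sym (mult (Tmap S hf t)) ⟩
      α (Tmap S α (Tmap S hf t))
    ≡⟨ respects-≈ (Tmap-∘ hf α t) ⟩
      α (Tmap S (λ n → α (hf n)) t)
    ∎
    where
      open IsEMAlgebra em
      open ≡-Reasoning
      hf : ℕ → T S _
      hf n = Tmap S h (f n)

mainTheorem1 : (S : Signature) (A : Set) (_⊑_ : A → A → Set) →
               IsPreorder _≡_ _⊑_ →
               (α : T S A → A) → IsEMAlgebra S α →
               (a b : T S ℕ) → Below S _⊑_ α a b →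
               (f : ℕ → T S ℕ) →
               Below S _⊑_ α (_* S f a) (_* S f b)
mainTheorem1 S A _⊑_ _ α em a b a⊑b f h =
  subst₂ _⊑_ (sym (evaluate-* S α em f h a)) (sym (evaluate-* S α em f h b))
             (a⊑b (λ n → α (Tmap S h (f n))))
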